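{- Let $\sum_{p\in \mathrm{enc}(\phi)}q_pp+\sum_{u}q_u(1-2u)+q+1=0$ be a Q-SoS, Q-SA or QNS refutation of a false QBF $\mathcal Q.\phi$. Then the universal strategy that sets each universal variable $u$ to $\frac12(1-\operatorname{sign}(q_u))$, where $q_u$ is evaluated on the current assignment of the variables to the left of $u$ and $\operatorname{sign}(0)=+1$, is a countermodel: for every choice of the existential variables, the resulting total assignment falsifies $\phi$.
   Context: A QBF $\mathcal Q.\phi$ consists of a quantifier prefix $\mathcal Q$ quantifying each variable of a finite set $V$ exactly once (existentially or universally, in a linear order) and a CNF $\phi$ over $V$. For each $v\in V$ let $\overline v$ be a twin variable; Boolean assignments $\alpha$ are extended by $\overline v\mapsto1-\alpha(v)$. A clause $C=\bigvee_{v\in P}v\vee\bigvee_{v\in N}\neg v$ is encoded as $\mathrm{enc}(C)=\{\prod_{v\in P}\overline v\prod_{v\in N}v\}\cup\{v^2-v,\ v+\overline v-1: v\in P\cup N\}$, and $\mathrm{enc}(\phi)=\bigcup_{C\in\phi}\mathrm{enc}(C)$. A Q-SoS refutation is a polynomial identity in $\mathbb Q[V\cup\overline V]$ of the displayed form where $u$ ranges over universal variables, every variable $v$ or $\overline v$ occurring in $q_u$ has $v$ quantified to the left of $u$, and $q$ is a sum of squares; for Q-SA $q$ has nonnegative coefficients; for QNS $q=0$. -}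

module Defs where

open import Data.Nat as ℕ using (ℕ; zero; suc)
open import Data.Fin as Fin using (Fin; toℕ)
open import Data.Fin.Properties using () renaming (_≟_ to _≟ᶠ_)
open import Data.Bool using (Bool; true; false; if_then_else_; _∧_)
open import Data.Product using (_×_; _,_; proj₁; proj₂; Σ; ∃)
open import Data.List as List using (List; []; _∷_; _++_; concatMap; foldr; length; allFin)
open import Data.List.Relation.Unary.Any using (Any)
open import Data.List.Relation.Unary.All using (All)
open import Data.List.Membership.Propositional using (_∈_)
open import Data.Vec as Vec using (Vec)
import Data.Vec.Properties as VecP
open import Data.Rational as ℚ using (ℚ; 0ℚ; 1ℚ; _+_; _*_; -_; _≤_; _<_)
open import Data.Rational.Properties using (_<?_)
open import Relation.Nullary using (¬_; does; yes; no)
open import Relation.Binary.PropositionalEquality using (_≡_)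
open import Data.Nat.Properties using () renaming (_≟_ to _≟ℕ_)

-- QBFs.  Variables are Fin n; the quantifier order is the order of Fin n
-- (variable i is quantified to the left of j iff i < j).

data Quant : Set where
  ∃q ∀q : Quant

-- a literal: (v , true) is v, (v , false) is ¬ v
Lit : ℕ → Set
Lit n = Fin n × Bool

Clause : ℕ → Set
Clause n = List (Lit n)

CNF : ℕ → Set
CNF n = List (Clause n)

record QBF (n : ℕ) : Set where
  field
    prefix : Fin n → Quant
    matrix : CNF n

Assignment : ℕ → Set
Assignment n = Fin n → Bool

litTrue : ∀ {n} → Assignment n → Lit n → Set
litTrue α (v , s) = α v ≡ s

Falsifies : ∀ {n} → Assignment n → CNF n → Set
Falsifies α φ = Any (λ C → All (λ l → ¬ litTrue α l) C) φ

-- A monomial is a pair of exponent vectors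
-- (exponents of v₀..v_{n-1}, exponents of v̄₀..v̄_{n-1}); a polynomial is a
-- finite list of terms (coefficient , monomial).

Monomial : ℕ → Set
Monomial n = Vec ℕ n × Vec ℕ n

_≟m_ : ∀ {n} (m m' : Monomial n) → Relation.Nullary.Dec (m ≡ m')
_≟m_ (a , b) (a' , b') with VecP.≡-dec _≟ℕ_ a a' | VecP.≡-dec _≟ℕ_ b b'
... | yes Relation.Binary.PropositionalEquality.refl | yes Relation.Binary.PropositionalEquality.refl = yes Relation.Binary.PropositionalEquality.refl
... | no p | _ = no λ { Relation.Binary.PropositionalEquality.refl → p Relation.Binary.PropositionalEquality.refl }
... | yes _ | no q = no λ { Relation.Binary.PropositionalEquality.refl → q Relation.Binary.PropositionalEquality.refl }

oneM : ∀ {n} → Monomial n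
oneM = Vec.replicate _ 0 , Vec.replicate _ 0

_·m_ : ∀ {n} → Monomial n → Monomial n → Monomial n
(a , b) ·m (a' , b') = Vec.zipWith ℕ._+_ a a' , Vec.zipWith ℕ._+_ b b'

Poly : ℕ → Set
Poly n = List (ℚ × Monomial n)

coeff : ∀ {n} → Poly n → Monomial n → ℚ
coeff [] m = 0ℚ
coeff ((c , m') ∷ p) m = (if does (m' ≟m m) then c else 0ℚ) + coeff p m

_≈P_ : ∀ {n} → Poly n → Poly n → Set
p ≈P q = ∀ m → coeff p m ≡ coeff q m

Occurs : ∀ {n} → Fin n → Poly n → Set
Occurs v p = ∃ λ m → ¬ (coeff p m ≡ 0ℚ) × (¬ (Vec.lookup (proj₁ m) v ≡ 0) Data.Sum.⊎ ¬ (Vec.lookup (proj₂ m) v ≡ 0))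
  where import Data.Sum

0P : ∀ {n} → Poly n
0P = []

constP : ∀ {n} → ℚ → Poly n
constP c = (c , oneM) ∷ []

1P : ∀ {n} → Poly n
1P = constP 1ℚ

varP : ∀ {n} → Fin n → Poly n
varP v = (1ℚ , Vec.updateAt (proj₁ oneM) v (λ _ → 1) , proj₂ oneM) ∷ []

twinP : ∀ {n} → Fin n → Poly n
twinP v = (1ℚ , proj₁ oneM , Vec.updateAt (proj₂ oneM) v (λ _ → 1)) ∷ []

_+P_ : ∀ {n} → Poly n → Poly n → Poly n
p +P q = p ++ q

_*P_ : ∀ {n} → Poly n → Poly n → Poly n
p *P q = concatMap (λ { (c , m) → List.map (λ { (d , m') → (c * d , m ·m m') }) q }) p

-P_ : ∀ {n} → Poly n → Poly n
-P p = List.map (λ { (c , m) → (- c , m) }) p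

_-P_ : ∀ {n} → Poly n → Poly n → Poly n
p -P q = p +P (-P q)

sumP : ∀ {n} → List (Poly n) → Poly n
sumP = foldr _+P_ 0P

b2q : Bool → ℚ
b2q true = 1ℚ
b2q false = 0ℚ

powℚ : ℚ → ℕ → ℚ
powℚ x zero = 1ℚ
powℚ x (suc k) = x * powℚ x k

evalM : ∀ {n} → Assignment n → Monomial n → ℚ
evalM {n} α (a , b) =
  foldr (λ i r → powℚ (b2q (α i)) (Vec.lookup a i) * (powℚ (1ℚ ℚ.- b2q (α i)) (Vec.lookup b i) * r)) 1ℚ (allFin n)

eval : ∀ {n} → Assignment n → Poly n → ℚ
eval α [] = 0ℚ
eval α ((c , m) ∷ p) = c * evalM α m + eval α p

-- Encoding of clauses.  For C = ⋁_{v∈P} v ∨ ⋁_{v∈N} ¬v (P, N as sets):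
-- enc(C) = { ∏_{v∈P} v̄ ∏_{v∈N} v } ∪ { v² - v , v + v̄ - 1 : v ∈ P ∪ N }.

memLit : ∀ {n} → Fin n → Bool → Clause n → Bool
memLit v s [] = false
memLit v s ((w , t) ∷ C) =
  if does (v ≟ᶠ w) ∧ does (s Data.Bool.≟ t) then true else memLit v s C
  where import Data.Bool

clauseMonomial : ∀ {n} → Clause n → Monomial n
clauseMonomial C =
  Vec.tabulate (λ v → if memLit v false C then 1 else 0) ,
  Vec.tabulate (λ v → if memLit v true C then 1 else 0)

encClause : ∀ {n} → Clause n → List (Poly n)
encClause C =
  ((1ℚ , clauseMonomial C) ∷ [])
  ∷ concatMap (λ { (v , _) → ((varP v *P varP v) -P varP v)
                           ∷ ((varP v +P twinP v) -P 1P) ∷ [] }) C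

enc : ∀ {n} → CNF n → List (Poly n)
enc φ = concatMap encClause φ

data System : Set where
  Q-SoS Q-SA QNS : System

IsSoS : ∀ {n} → Poly n → Set
IsSoS q = ∃ λ (gs : List (Poly _)) → q ≈P sumP (List.map (λ g → g *P g) gs)

NonnegCoeffs : ∀ {n} → Poly n → Set
NonnegCoeffs q = ∀ m → 0ℚ ≤ coeff q m

Allowed : ∀ {n} → System → Poly n → Set
Allowed Q-SoS q = IsSoS q
Allowed Q-SA  q = NonnegCoeffs q
Allowed QNS   q = q ≈P 0P

universalTerm : ∀ {n} → (Fin n → Quant) → (Fin n → Poly n) → Fin n → Poly n
universalTerm prefix qu u with prefix u
... | ∀q = qu u *P (1P -P (constP (1ℚ + 1ℚ) *P varP u))
... | ∃q = 0P

record Refutation (S : System) {n : ℕ} (F : QBF n) : Set where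
  open QBF F
  field
    qp  : Fin (length (enc matrix)) → Poly n
    qu  : Fin n → Poly n
    q   : Poly n
    qu-left : ∀ u → prefix u ≡ ∀q → ∀ v → Occurs v (qu u) → v Fin.< u
    q-allowed : Allowed S q
    identity :
      (sumP (List.map (λ i → qp i *P List.lookup (enc matrix) i) (allFin _))
        +P (sumP (List.map (λ u → universalTerm prefix qu u) (allFin n))
        +P (q +P 1P))) ≈P 0P

-- The universal strategy: u ↦ ½(1 - sign(q_u(α|<u))), sign(0) = +1,
-- i.e. u is set to true (1) iff q_u evaluated on the assignment of the
-- variables to the left of u is negative.

-- α restricted to variables left of u (other variables set to 0; by
-- qu-left they do not occur in q_u, so the value is immaterial)
restrictLeft : ∀ {n} → Assignment n → Fin n → Assignment n
restrictLeft α u v = if does (toℕ v Data.Nat.<? toℕ u) then α v else false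
  where import Data.Nat

strategy : ∀ {n} → (Fin n → Poly n) → Fin n → Assignment n → Bool
strategy qu u α = does (eval (restrictLeft α u) (qu u) <? 0ℚ)

-- α is a total assignment produced by some play of the existential player
-- against the strategy: every universal variable takes the strategy's value
FollowsStrategy : ∀ {n} → (Fin n → Quant) → (Fin n → Poly n) → Assignment n → Set
FollowsStrategy prefix qu α = ∀ u → prefix u ≡ ∀q → α u ≡ strategy qu u α

-- Evaluate the refutation identity at a total assignment α played against the
-- strategy, and suppose α satisfies φ. Every polynomial of enc(φ) vanishes at α: the
-- clause monomial has a factor v̄ or v that is 0 at a true literal of the clause, and
-- the other generators vanish on Boolean points. The value of q is nonnegative in each
-- system (a sum of squares, a polynomial with nonnegative coefficients at a 0/1 point,
-- or 0). Each q_u (1 - 2u) is nonnegative too: q_u only involves variables left of u,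
-- so it takes the value the strategy saw, and the strategy chose u so that 1 - 2u has
-- the sign of that value. Hence the left-hand side evaluates to at least 1, not 0.

module Submission where

open import Defs
open import Data.Nat as ℕ using (ℕ; zero; suc)
import Data.Nat.Properties as ℕ
open import Data.Fin as Fin using (Fin; toℕ; punchIn)
open import Data.Fin.Properties using (punchInᵢ≢i) renaming (_≟_ to _≟ᶠ_)
open import Data.Bool using (true; false; if_then_else_; _∧_)
import Data.Bool as Bool
open import Data.Product using (_×_; _,_; proj₁; proj₂)
open import Data.Sum using (_⊎_; inj₁; inj₂)
open import Data.List as List using ([]; _∷_; _++_; length; allFin)
open import Data.List.Relation.Unary.Any as Any using (Any; here; there)
open import Data.List.Relation.Unary.All as All using (All; []; _∷_)
open import Data.List.Relation.Unary.All.Properties using (¬Any⇒All¬; ¬All⇒Any¬; map⁺; concat⁺)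
open import Data.List.Membership.Propositional using (_∈_; find)
open import Data.List.Membership.Propositional.Properties using (∈-lookup)
open import Data.Vec as Vec using (Vec)
import Data.Vec.Properties as Vec
open import Data.Rational as ℚ using (ℚ; 0ℚ; 1ℚ; _+_; _*_; -_; _-_; _≤_; _<_)
open import Data.Rational.Properties
open import Algebra.Bundles using (CommutativeMonoid)
open import Algebra.Properties.CommutativeMonoid.Sum *-1-commutativeMonoid using ()
  renaming (sum to ∏; sum-cong-≗ to ∏-cong; ∑-distrib-+ to ∏-distrib-*; sum-remove to ∏-remove)
open import Algebra.Properties.CommutativeSemigroup
  (CommutativeMonoid.commutativeSemigroup *-1-commutativeMonoid) using (interchange)
open import Algebra.Properties.Group +-0-group using (x∙y⁻¹≈ε⇒x≈y)
open import Relation.Nullary using (¬_; Dec; does; yes; no; ¬?)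
open import Relation.Nullary.Decidable using (decidable-stable; dec-true; dec-false)
open import Relation.Binary.PropositionalEquality
open import Data.Empty using (⊥; ⊥-elim)
open import Function using (_∘_; id)

*-nonNeg : ∀ {p q} → 0ℚ ≤ p → 0ℚ ≤ q → 0ℚ ≤ p * q
*-nonNeg {p} {q} 0≤p 0≤q =
  nonNegative⁻¹ (p * q) {{nonNeg*nonNeg⇒nonNeg p {{ℚ.nonNegative 0≤p}} q {{ℚ.nonNegative 0≤q}}}}

*-nonPos : ∀ {p q} → p ≤ 0ℚ → q ≤ 0ℚ → 0ℚ ≤ p * q
*-nonPos {p} {q} p≤0 q≤0 =
  nonNegative⁻¹ (p * q) {{nonPos*nonPos⇒nonPos p {{ℚ.nonPositive p≤0}} q {{ℚ.nonPositive q≤0}}}}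

+-nonNeg : ∀ {p q} → 0ℚ ≤ p → 0ℚ ≤ q → 0ℚ ≤ p + q
+-nonNeg = +-mono-≤

square-nonNeg : ∀ p → 0ℚ ≤ p * p
square-nonNeg p with ≤-total 0ℚ p
... | inj₁ 0≤p = *-nonNeg 0≤p 0≤p
... | inj₂ p≤0 = *-nonPos p≤0 p≤0

powℚ-+ : ∀ x k l → powℚ x (k ℕ.+ l) ≡ powℚ x k * powℚ x l
powℚ-+ x zero    l = sym (*-identityˡ _)
powℚ-+ x (suc k) l = trans (cong (x *_) (powℚ-+ x k l)) (sym (*-assoc x _ _))

powℚ-nonNeg : ∀ {x} k → 0ℚ ≤ x → 0ℚ ≤ powℚ x k
powℚ-nonNeg zero    0≤x = nonNegative⁻¹ 1ℚ
powℚ-nonNeg (suc k) 0≤x = *-nonNeg 0≤x (powℚ-nonNeg k 0≤x)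

∏-ones : ∀ {n} (f : Fin n → ℚ) → (∀ i → f i ≡ 1ℚ) → ∏ f ≡ 1ℚ
∏-ones {zero}  f f≡1 = refl
∏-ones {suc n} f f≡1 =
  trans (cong₂ _*_ (f≡1 Fin.zero) (∏-ones _ (f≡1 ∘ Fin.suc))) (*-identityˡ 1ℚ)

∏-single : ∀ {n} (f : Fin n → ℚ) i → (∀ j → j ≢ i → f j ≡ 1ℚ) → ∏ f ≡ f i
∏-single {suc n} f i f≡1 =
  begin
    ∏ f                     ≡⟨ ∏-remove {i = i} f ⟩
    f i * ∏ (f ∘ punchIn i) ≡⟨ cong (f i *_) (∏-ones _ (λ j → f≡1 (punchIn i j) (punchInᵢ≢i i j))) ⟩
    f i * 1ℚ                ≡⟨ *-identityʳ (f i) ⟩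
    f i ∎
  where open ≡-Reasoning

∏-zero : ∀ {n} (f : Fin n → ℚ) i → f i ≡ 0ℚ → ∏ f ≡ 0ℚ
∏-zero {suc n} f i fi≡0 =
  trans (∏-remove {i = i} f) (trans (cong (_* ∏ (f ∘ punchIn i)) fi≡0) (*-zeroˡ (∏ (f ∘ punchIn i))))

∏-nonNeg : ∀ {n} (f : Fin n → ℚ) → (∀ i → 0ℚ ≤ f i) → 0ℚ ≤ ∏ f
∏-nonNeg {zero}  f 0≤f = nonNegative⁻¹ 1ℚ
∏-nonNeg {suc n} f 0≤f = *-nonNeg (0≤f Fin.zero) (∏-nonNeg _ (λ i → 0≤f (Fin.suc i)))

monomialFactor : ∀ {n} → Assignment n → Monomial n → Fin n → ℚ
monomialFactor α (a , b) i =
  powℚ (b2q (α i)) (Vec.lookup a i) * powℚ (1ℚ - b2q (α i)) (Vec.lookup b i)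

evalM≡∏ : ∀ {n} (α : Assignment n) m → evalM α m ≡ ∏ (monomialFactor α m)
evalM≡∏ {n} α (a , b) = foldr-tabulate id
  where
  X Y : Fin n → ℚ
  X i = powℚ (b2q (α i)) (Vec.lookup a i)
  Y i = powℚ (1ℚ - b2q (α i)) (Vec.lookup b i)
  foldr-tabulate : ∀ {k} (f : Fin k → Fin n) →
    List.foldr (λ i r → X i * (Y i * r)) 1ℚ (List.tabulate f) ≡ ∏ (λ j → X (f j) * Y (f j))
  foldr-tabulate {zero}  f = refl
  foldr-tabulate {suc k} f =
    trans (cong (λ r → X (f Fin.zero) * (Y (f Fin.zero) * r)) (foldr-tabulate (f ∘ Fin.suc)))
          (sym (*-assoc (X (f Fin.zero)) _ _))

monomialFactor-unit : ∀ {n} (α : Assignment n) (a b : Vec ℕ n) i →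
  Vec.lookup a i ≡ 0 → Vec.lookup b i ≡ 0 → monomialFactor α (a , b) i ≡ 1ℚ
monomialFactor-unit α a b i a≡0 b≡0 rewrite a≡0 | b≡0 = refl

monomialFactor-nonNeg : ∀ {n} (α : Assignment n) m i → 0ℚ ≤ monomialFactor α m i
monomialFactor-nonNeg α (a , b) i =
  *-nonNeg (powℚ-nonNeg (Vec.lookup a i) (b2q-nonNeg (α i)))
           (powℚ-nonNeg (Vec.lookup b i) (1-b2q-nonNeg (α i)))
  where
  b2q-nonNeg : ∀ x → 0ℚ ≤ b2q x
  b2q-nonNeg true  = nonNegative⁻¹ 1ℚ
  b2q-nonNeg false = nonNegative⁻¹ 0ℚ
  1-b2q-nonNeg : ∀ x → 0ℚ ≤ 1ℚ - b2q x
  1-b2q-nonNeg true  = nonNegative⁻¹ 0ℚ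
  1-b2q-nonNeg false = nonNegative⁻¹ 1ℚ

evalM-nonNeg : ∀ {n} (α : Assignment n) m → 0ℚ ≤ evalM α m
evalM-nonNeg α m rewrite evalM≡∏ α m = ∏-nonNeg _ (monomialFactor-nonNeg α m)

evalM-·m : ∀ {n} (α : Assignment n) m m′ → evalM α (m ·m m′) ≡ evalM α m * evalM α m′
evalM-·m α (a , b) (a′ , b′)
  rewrite evalM≡∏ α ((a , b) ·m (a′ , b′)) | evalM≡∏ α (a , b) | evalM≡∏ α (a′ , b′) =
  trans (∏-cong factor-·) (∏-distrib-* (monomialFactor α (a , b)) (monomialFactor α (a′ , b′)))
  where
  factor-· : ∀ i → monomialFactor α ((a , b) ·m (a′ , b′)) i
                 ≡ monomialFactor α (a , b) i * monomialFactor α (a′ , b′) i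
  factor-· i rewrite Vec.lookup-zipWith ℕ._+_ i a a′ | Vec.lookup-zipWith ℕ._+_ i b b′
                   | powℚ-+ (b2q (α i)) (Vec.lookup a i) (Vec.lookup a′ i)
                   | powℚ-+ (1ℚ - b2q (α i)) (Vec.lookup b i) (Vec.lookup b′ i) =
    interchange (powℚ x (Vec.lookup a i)) (powℚ x (Vec.lookup a′ i))
                (powℚ (1ℚ - x) (Vec.lookup b i)) (powℚ (1ℚ - x) (Vec.lookup b′ i))
    where x = b2q (α i)

evalM-oneM : ∀ {n} (α : Assignment n) → evalM α oneM ≡ 1ℚ
evalM-oneM {n} α rewrite evalM≡∏ α (oneM {n}) =
  ∏-ones _ (λ i → monomialFactor-unit α zeros zeros i (Vec.lookup-replicate i 0) (Vec.lookup-replicate i 0))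
  where
  zeros : Vec ℕ n
  zeros = Vec.replicate n 0

module _ {n : ℕ} (α : Assignment n) where

  eval-++ : ∀ (p q : Poly n) → eval α (p ++ q) ≡ eval α p + eval α q
  eval-++ []            q = sym (+-identityˡ _)
  eval-++ ((c , m) ∷ p) q =
    trans (cong (c * evalM α m +_) (eval-++ p q)) (sym (+-assoc (c * evalM α m) _ _))

  eval-neg : ∀ (p : Poly n) → eval α (-P p) ≡ - eval α p
  eval-neg []            = refl
  eval-neg ((c , m) ∷ p) =
    trans (cong₂ _+_ (sym (neg-distribˡ-* c (evalM α m))) (eval-neg p))
          (sym (neg-distrib-+ (c * evalM α m) (eval α p)))

  eval-sub : ∀ (p q : Poly n) → eval α (p -P q) ≡ eval α p - eval α q
  eval-sub p q = trans (eval-++ p (-P q)) (cong (eval α p +_) (eval-neg q))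

  eval-* : ∀ (p q : Poly n) → eval α (p *P q) ≡ eval α p * eval α q
  eval-* []            q = sym (*-zeroˡ (eval α q))
  eval-* ((c , m) ∷ p) q =
    begin
      eval α (List.map (scale c m) q ++ p *P q)
        ≡⟨ eval-++ (List.map (scale c m) q) (p *P q) ⟩
      eval α (List.map (scale c m) q) + eval α (p *P q)
        ≡⟨ cong₂ _+_ (eval-scale c m q) (eval-* p q) ⟩
      (c * evalM α m) * eval α q + eval α p * eval α q
        ≡⟨ sym (*-distribʳ-+ (eval α q) (c * evalM α m) (eval α p)) ⟩
      (c * evalM α m + eval α p) * eval α q ∎
    where
    open ≡-Reasoning
    scale : ℚ → Monomial n → ℚ × Monomial n → ℚ × Monomial n
    scale c m (d , m′) = c * d , m ·m m′
    eval-scale : ∀ c m q → eval α (List.map (scale c m) q) ≡ (c * evalM α m) * eval α q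
    eval-scale c m []             = sym (*-zeroʳ (c * evalM α m))
    eval-scale c m ((d , m′) ∷ q) =
      trans (cong₂ _+_ (trans (cong (c * d *_) (evalM-·m α m m′))
                              (interchange c d (evalM α m) (evalM α m′)))
                       (eval-scale c m q))
            (sym (*-distribˡ-+ (c * evalM α m) (d * evalM α m′) (eval α q)))

  eval-constP : ∀ c → eval α (constP c) ≡ c
  eval-constP c rewrite evalM-oneM α = trans (+-identityʳ _) (*-identityʳ c)

  private
    eval-unitMonomial : ∀ (a b : Vec ℕ n) v → (∀ i → i ≢ v → monomialFactor α (a , b) i ≡ 1ℚ) →
      eval α ((1ℚ , a , b) ∷ []) ≡ monomialFactor α (a , b) v
    eval-unitMonomial a b v unit =
      trans (+-identityʳ _) (trans (*-identityˡ _) (trans (evalM≡∏ α (a , b)) (∏-single _ v unit)))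

    zeros : Vec ℕ n
    zeros = Vec.replicate n 0

    unit-off : ∀ v i → i ≢ v → Vec.lookup (Vec.updateAt zeros v (λ _ → 1)) i ≡ 0
    unit-off v i i≢v = trans (Vec.lookup∘updateAt′ i v i≢v zeros) (Vec.lookup-replicate i 0)

    unit-on : ∀ v → Vec.lookup (Vec.updateAt zeros v (λ _ → 1)) v ≡ 1
    unit-on v = Vec.lookup∘updateAt v zeros

  eval-varP : ∀ v → eval α (varP v) ≡ b2q (α v)
  eval-varP v =
    begin
      eval α (varP v)
        ≡⟨ eval-unitMonomial unit zeros v
             (λ i i≢v → monomialFactor-unit α unit zeros i (unit-off v i i≢v) (Vec.lookup-replicate i 0)) ⟩
      powℚ (b2q (α v)) (Vec.lookup unit v) * powℚ (1ℚ - b2q (α v)) (Vec.lookup zeros v)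
        ≡⟨ cong₂ (λ k l → powℚ (b2q (α v)) k * powℚ (1ℚ - b2q (α v)) l)
                 (unit-on v) (Vec.lookup-replicate v 0) ⟩
      (b2q (α v) * 1ℚ) * 1ℚ
        ≡⟨ trans (*-identityʳ _) (*-identityʳ _) ⟩
      b2q (α v) ∎
    where
    open ≡-Reasoning
    unit = Vec.updateAt zeros v (λ _ → 1)

  eval-twinP : ∀ v → eval α (twinP v) ≡ 1ℚ - b2q (α v)
  eval-twinP v =
    begin
      eval α (twinP v)
        ≡⟨ eval-unitMonomial zeros unit v
             (λ i i≢v → monomialFactor-unit α zeros unit i (Vec.lookup-replicate i 0) (unit-off v i i≢v)) ⟩
      powℚ (b2q (α v)) (Vec.lookup zeros v) * powℚ (1ℚ - b2q (α v)) (Vec.lookup unit v)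
        ≡⟨ cong₂ (λ k l → powℚ (b2q (α v)) k * powℚ (1ℚ - b2q (α v)) l)
                 (Vec.lookup-replicate v 0) (unit-on v) ⟩
      1ℚ * ((1ℚ - b2q (α v)) * 1ℚ)
        ≡⟨ trans (*-identityˡ _) (*-identityʳ _) ⟩
      1ℚ - b2q (α v) ∎
    where
    open ≡-Reasoning
    unit = Vec.updateAt zeros v (λ _ → 1)

coeff-++ : ∀ {n} (p q : Poly n) m → coeff (p ++ q) m ≡ coeff p m + coeff q m
coeff-++ []             q m = sym (+-identityˡ _)
coeff-++ ((c , m′) ∷ p) q m =
  trans (cong (x +_) (coeff-++ p q m)) (sym (+-assoc x (coeff p m) (coeff q m)))
  where x = if does (m′ ≟m m) then c else 0ℚ

coeff-neg : ∀ {n} (p : Poly n) m → coeff (-P p) m ≡ - coeff p m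
coeff-neg []             m = refl
coeff-neg ((c , m′) ∷ p) m with does (m′ ≟m m)
... | true  = trans (cong (- c +_) (coeff-neg p m)) (sym (neg-distrib-+ c (coeff p m)))
... | false = trans (cong (0ℚ +_) (coeff-neg p m)) (sym (neg-distrib-+ 0ℚ (coeff p m)))

removeMonomial : ∀ {n} → Monomial n → Poly n → Poly n
removeMonomial t []            = []
removeMonomial t ((c , m) ∷ p) =
  if does (m ≟m t) then removeMonomial t p else (c , m) ∷ removeMonomial t p

length-removeMonomial : ∀ {n} (t : Monomial n) p → length (removeMonomial t p) ℕ.≤ length p
length-removeMonomial t []            = ℕ.z≤n
length-removeMonomial t ((c , m) ∷ p) with does (m ≟m t)
... | true  = ℕ.m≤n⇒m≤1+n (length-removeMonomial t p)
... | false = ℕ.s≤s (length-removeMonomial t p)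

removeMonomial-head : ∀ {n} c (t : Monomial n) p → removeMonomial t ((c , t) ∷ p) ≡ removeMonomial t p
removeMonomial-head c t p with t ≟m t
... | yes _   = refl
... | no t≢t = ⊥-elim (t≢t refl)

eval-removeMonomial : ∀ {n} (α : Assignment n) t p →
  eval α p ≡ coeff p t * evalM α t + eval α (removeMonomial t p)
eval-removeMonomial α t []            = sym (trans (+-identityʳ _) (*-zeroˡ (evalM α t)))
eval-removeMonomial α t ((c , m) ∷ p) with m ≟m t
... | yes refl =
  begin
    c * evalM α t + eval α p
      ≡⟨ cong (c * evalM α t +_) (eval-removeMonomial α t p) ⟩
    c * evalM α t + (coeff p t * evalM α t + rest)
      ≡⟨ sym (+-assoc (c * evalM α t) _ _) ⟩
    (c * evalM α t + coeff p t * evalM α t) + rest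
      ≡⟨ cong (_+ rest) (sym (*-distribʳ-+ (evalM α t) c (coeff p t))) ⟩
    (c + coeff p t) * evalM α t + rest ∎
  where
  open ≡-Reasoning
  rest = eval α (removeMonomial t p)
... | no _ =
  begin
    c * evalM α m + eval α p
      ≡⟨ cong (c * evalM α m +_) (eval-removeMonomial α t p) ⟩
    c * evalM α m + (coeff p t * evalM α t + rest)
      ≡⟨ sym (+-assoc (c * evalM α m) _ _) ⟩
    (c * evalM α m + coeff p t * evalM α t) + rest
      ≡⟨ cong (_+ rest) (+-comm (c * evalM α m) _) ⟩
    (coeff p t * evalM α t + c * evalM α m) + rest
      ≡⟨ +-assoc (coeff p t * evalM α t) _ _ ⟩
    coeff p t * evalM α t + (c * evalM α m + rest)
      ≡⟨ cong (λ x → x * evalM α t + (c * evalM α m + rest)) (sym (+-identityˡ (coeff p t))) ⟩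
    (0ℚ + coeff p t) * evalM α t + (c * evalM α m + rest) ∎
  where
  open ≡-Reasoning
  rest = eval α (removeMonomial t p)

coeff-removeMonomial-self : ∀ {n} t (p : Poly n) → coeff (removeMonomial t p) t ≡ 0ℚ
coeff-removeMonomial-self t []            = refl
coeff-removeMonomial-self t ((c , m) ∷ p) with m ≟m t
... | yes refl = coeff-removeMonomial-self t p
... | no m≢t rewrite dec-false (m ≟m t) m≢t = trans (+-identityˡ _) (coeff-removeMonomial-self t p)

coeff-removeMonomial-other : ∀ {n} t (p : Poly n) m → m ≢ t → coeff (removeMonomial t p) m ≡ coeff p m
coeff-removeMonomial-other t []             m m≢t = refl
coeff-removeMonomial-other t ((c , m′) ∷ p) m m≢t with m′ ≟m t
... | yes refl rewrite dec-false (t ≟m m) (m≢t ∘ sym) =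
  trans (coeff-removeMonomial-other t p m m≢t) (sym (+-identityˡ _))
... | no _ = cong ((if does (m′ ≟m m) then c else 0ℚ) +_) (coeff-removeMonomial-other t p m m≢t)

coeff-removeMonomial : ∀ {n} t (p : Poly n) m →
  coeff (removeMonomial t p) m ≡ 0ℚ ⊎ coeff (removeMonomial t p) m ≡ coeff p m
coeff-removeMonomial t p m with m ≟m t
... | yes refl = inj₁ (coeff-removeMonomial-self t p)
... | no m≢t   = inj₂ (coeff-removeMonomial-other t p m m≢t)

-- Grouped by monomial, eval α p is the sum over the distinct monomials m of p of
-- coeff p m * evalM α m; so a relation respecting + transfers from these summands.
eval-coeffwise : (_∼_ : ℚ → ℚ → Set) → 0ℚ ∼ 0ℚ →
  (∀ {a b c d} → a ∼ b → c ∼ d → (a + c) ∼ (b + d)) →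
  ∀ {n} (α β : Assignment n) p → (∀ m → (coeff p m * evalM α m) ∼ (coeff p m * evalM β m)) →
  eval α p ∼ eval β p
eval-coeffwise _∼_ 0∼0 +-pres α β p termwise = bounded (length p) p ℕ.≤-refl termwise
  where
  bounded : ∀ k p → length p ℕ.≤ k →
    (∀ m → (coeff p m * evalM α m) ∼ (coeff p m * evalM β m)) → eval α p ∼ eval β p
  bounded k       []            _           _        = 0∼0
  bounded (suc k) ((c , t) ∷ p) (ℕ.s≤s len) termwise =
    subst₂ _∼_ (sym (eval-removeMonomial α t q)) (sym (eval-removeMonomial β t q))
      (+-pres (termwise t) (bounded k r (ℕ.≤-trans shorter len) termwise-r))
    where
    q = (c , t) ∷ p
    r = removeMonomial t q
    shorter : length r ℕ.≤ length p
    shorter = subst (λ x → length x ℕ.≤ length p) (sym (removeMonomial-head c t p))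
                    (length-removeMonomial t p)
    termwise-r : ∀ m → (coeff r m * evalM α m) ∼ (coeff r m * evalM β m)
    termwise-r m with coeff-removeMonomial t q m
    ... | inj₁ r≡0 = subst (λ x → (x * evalM α m) ∼ (x * evalM β m)) (sym r≡0)
                       (subst₂ _∼_ (sym (*-zeroˡ (evalM α m))) (sym (*-zeroˡ (evalM β m))) 0∼0)
    ... | inj₂ r≡q = subst (λ x → (x * evalM α m) ∼ (x * evalM β m)) (sym r≡q) (termwise m)

module _ {n : ℕ} (α : Assignment n) where

  eval-coeff-zero : ∀ p → (∀ m → coeff p m ≡ 0ℚ) → eval α p ≡ 0ℚ
  eval-coeff-zero p p≡0 =
    eval-coeffwise (λ a _ → a ≡ 0ℚ) refl (λ a≡0 c≡0 → trans (cong₂ _+_ a≡0 c≡0) (+-identityˡ 0ℚ))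
      α α p (λ m → trans (cong (_* evalM α m) (p≡0 m)) (*-zeroˡ (evalM α m)))

  eval-nonNeg : ∀ p → NonnegCoeffs p → 0ℚ ≤ eval α p
  eval-nonNeg p 0≤p =
    eval-coeffwise (λ a _ → 0ℚ ≤ a) ≤-refl +-nonNeg α α p (λ m → *-nonNeg (0≤p m) (evalM-nonNeg α m))

  eval-≈P : ∀ p q → p ≈P q → eval α p ≡ eval α q
  eval-≈P p q p≈q =
    x∙y⁻¹≈ε⇒x≈y (eval α p) (eval α q) (trans (sym (eval-sub α p q)) (eval-coeff-zero (p -P q) diff≡0))
    where
    diff≡0 : ∀ m → coeff (p -P q) m ≡ 0ℚ
    diff≡0 m =
      trans (coeff-++ p (-P q) m) (trans (cong₂ _+_ (p≈q m) (coeff-neg q m)) (+-inverseʳ (coeff q m)))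

memLit-∈ : ∀ {n} {v : Fin n} {s C} → (v , s) ∈ C → memLit v s C ≡ true
memLit-∈ {v = v} {s} (here refl) rewrite dec-true (v ≟ᶠ v) refl | dec-true (s Bool.≟ s) refl = refl
memLit-∈ {v = v} {s} {(w , t) ∷ C} (there v∈C) with does (v ≟ᶠ w) ∧ does (s Bool.≟ t)
... | true  = refl
... | false = memLit-∈ v∈C

clauseMonomial-factor : ∀ {n} (α : Assignment n) C v → memLit v (α v) C ≡ true →
  monomialFactor α (clauseMonomial C) v ≡ 0ℚ
clauseMonomial-factor α C v v∈C
  rewrite Vec.lookup∘tabulate (λ w → if memLit w false C then 1 else 0) v
        | Vec.lookup∘tabulate (λ w → if memLit w true C then 1 else 0) v
  with α v
... | true  rewrite v∈C = *-zeroʳ (powℚ 1ℚ (if memLit v false C then 1 else 0))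
... | false rewrite v∈C = *-zeroˡ (powℚ 1ℚ (if memLit v true C then 1 else 0))

eval-clauseMonomial : ∀ {n} (α : Assignment n) C → Any (litTrue α) C →
  eval α ((1ℚ , clauseMonomial C) ∷ []) ≡ 0ℚ
eval-clauseMonomial α C sat with find sat
... | (v , _) , v∈C , refl =
  trans (+-identityʳ _) (trans (*-identityˡ _) (trans (evalM≡∏ α (clauseMonomial C))
    (∏-zero _ v (clauseMonomial-factor α C v (memLit-∈ v∈C)))))

eval-boolean : ∀ {n} (α : Assignment n) v → eval α ((varP v *P varP v) -P varP v) ≡ 0ℚ
eval-boolean α v
  rewrite eval-sub α (varP v *P varP v) (varP v) | eval-* α (varP v) (varP v) | eval-varP α v
  with α v
... | true  = refl
... | false = refl

eval-twin : ∀ {n} (α : Assignment n) v → eval α ((varP v +P twinP v) -P 1P) ≡ 0ℚ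
eval-twin α v
  rewrite eval-sub α (varP v +P twinP v) 1P | eval-++ α (varP v) (twinP v)
        | eval-varP α v | eval-twinP α v | eval-constP α 1ℚ
  with α v
... | true  = refl
... | false = refl

enc-vanishes : ∀ {n} (α : Assignment n) φ → All (Any (litTrue α)) φ →
  All (λ p → eval α p ≡ 0ℚ) (enc φ)
enc-vanishes α φ sat = concat⁺ (map⁺ (All.map clause-vanishes sat))
  where
  clause-vanishes : ∀ {C} → Any (litTrue α) C → All (λ p → eval α p ≡ 0ℚ) (encClause C)
  clause-vanishes {C} satC =
    eval-clauseMonomial α C satC
    ∷ concat⁺ (map⁺ (All.universal (λ { (v , _) → eval-boolean α v ∷ eval-twin α v ∷ [] }) C))

module _ {n : ℕ} (α : Assignment n) (u : Fin n) where

  restrictLeft-left : ∀ v → v Fin.< u → restrictLeft α u v ≡ α v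
  restrictLeft-left v v<u = cong (λ b → if b then α v else false) (dec-true (toℕ v ℕ.<? toℕ u) v<u)

  evalM-restrictLeft : ∀ (a b : Vec ℕ n) →
    (∀ v → Vec.lookup a v ≢ 0 ⊎ Vec.lookup b v ≢ 0 → v Fin.< u) →
    evalM α (a , b) ≡ evalM (restrictLeft α u) (a , b)
  evalM-restrictLeft a b left =
    trans (evalM≡∏ α (a , b)) (trans (∏-cong factor≡) (sym (evalM≡∏ (restrictLeft α u) (a , b))))
    where
    factor≡ : ∀ i → monomialFactor α (a , b) i ≡ monomialFactor (restrictLeft α u) (a , b) i
    factor≡ i with toℕ i ℕ.<? toℕ u
    ... | yes i<u = cong (λ x → powℚ (b2q x) (Vec.lookup a i) * powℚ (1ℚ - b2q x) (Vec.lookup b i))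
                         (sym (restrictLeft-left i i<u))
    ... | no i≮u  = trans (monomialFactor-unit α a b i a≡0 b≡0)
                          (sym (monomialFactor-unit (restrictLeft α u) a b i a≡0 b≡0))
      where
      a≡0 = decidable-stable (Vec.lookup a i ℕ.≟ 0) (i≮u ∘ left i ∘ inj₁)
      b≡0 = decidable-stable (Vec.lookup b i ℕ.≟ 0) (i≮u ∘ left i ∘ inj₂)

  eval-restrictLeft : ∀ p → (∀ v → Occurs v p → v Fin.< u) → eval α p ≡ eval (restrictLeft α u) p
  eval-restrictLeft p left = eval-coeffwise _≡_ refl (cong₂ _+_) α (restrictLeft α u) p termwise
    where
    termwise : ∀ m → coeff p m * evalM α m ≡ coeff p m * evalM (restrictLeft α u) m
    termwise m with coeff p m ℚ.≟ 0ℚ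
    ... | yes c≡0 rewrite c≡0 = trans (*-zeroˡ (evalM α m)) (sym (*-zeroˡ (evalM (restrictLeft α u) m)))
    ... | no c≢0 =
      cong (coeff p m *_) (evalM-restrictLeft (proj₁ m) (proj₂ m) (λ v e → left v (m , c≢0 , e)))

strategy-sign-nonNeg : ∀ x (x<0? : Dec (x < 0ℚ)) → 0ℚ ≤ x * (1ℚ - (1ℚ + 1ℚ) * b2q (does x<0?))
strategy-sign-nonNeg x (yes x<0) = *-nonPos (<⇒≤ x<0) (nonPositive⁻¹ (1ℚ - (1ℚ + 1ℚ) * 1ℚ))
strategy-sign-nonNeg x (no x≮0)  = *-nonNeg (≮⇒≥ x≮0) (nonNegative⁻¹ (1ℚ - (1ℚ + 1ℚ) * 0ℚ))

eval-1-2u : ∀ {n} (α : Assignment n) u →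
  eval α (1P -P (constP (1ℚ + 1ℚ) *P varP u)) ≡ 1ℚ - (1ℚ + 1ℚ) * b2q (α u)
eval-1-2u α u =
  trans (eval-sub α 1P (constP (1ℚ + 1ℚ) *P varP u))
        (cong₂ _-_ (eval-constP α 1ℚ)
                   (trans (eval-* α (constP (1ℚ + 1ℚ)) (varP u))
                          (cong₂ _*_ (eval-constP α (1ℚ + 1ℚ)) (eval-varP α u))))

universalTerm-nonNeg : ∀ {n} (α : Assignment n) prefix qu →
  (∀ u → prefix u ≡ ∀q → ∀ v → Occurs v (qu u) → v Fin.< u) →
  FollowsStrategy prefix qu α → ∀ u → 0ℚ ≤ eval α (universalTerm prefix qu u)
universalTerm-nonNeg α prefix qu left follows u with prefix u in u-∀
... | ∃q = ≤-refl
... | ∀q =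
  subst (0ℚ ≤_) (sym eval≡) (strategy-sign-nonNeg _ (eval (restrictLeft α u) (qu u) <? 0ℚ))
  where
  eval≡ : eval α (qu u *P (1P -P (constP (1ℚ + 1ℚ) *P varP u)))
        ≡ eval (restrictLeft α u) (qu u) * (1ℚ - (1ℚ + 1ℚ) * b2q (strategy qu u α))
  eval≡ = trans (eval-* α (qu u) _)
                (cong₂ _*_ (eval-restrictLeft α u (qu u) (left u u-∀))
                           (trans (eval-1-2u α u)
                                  (cong (λ b → 1ℚ - (1ℚ + 1ℚ) * b2q b) (follows u u-∀))))

module _ {n : ℕ} (α : Assignment n) where

  eval-sumP-zero : ∀ {a} {A : Set a} (f : A → Poly n) xs →
    (∀ x → eval α (f x) ≡ 0ℚ) → eval α (sumP (List.map f xs)) ≡ 0ℚ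
  eval-sumP-zero f []       _      = refl
  eval-sumP-zero f (x ∷ xs) f≡0 =
    trans (eval-++ α (f x) _) (trans (cong₂ _+_ (f≡0 x) (eval-sumP-zero f xs f≡0)) (+-identityˡ 0ℚ))

  eval-sumP-nonNeg : ∀ {a} {A : Set a} (f : A → Poly n) xs →
    (∀ x → 0ℚ ≤ eval α (f x)) → 0ℚ ≤ eval α (sumP (List.map f xs))
  eval-sumP-nonNeg f []       _   = ≤-refl
  eval-sumP-nonNeg f (x ∷ xs) 0≤f =
    subst (0ℚ ≤_) (sym (eval-++ α (f x) _)) (+-nonNeg (0≤f x) (eval-sumP-nonNeg f xs 0≤f))

  allowed-nonNeg : ∀ S q → Allowed S q → 0ℚ ≤ eval α q
  allowed-nonNeg Q-SoS q (gs , q≈Σg²) =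
    subst (0ℚ ≤_) (sym (eval-≈P α q (sumP (List.map (λ g → g *P g) gs)) q≈Σg²))
      (eval-sumP-nonNeg (λ g → g *P g) gs
        (λ g → subst (0ℚ ≤_) (sym (eval-* α g g)) (square-nonNeg (eval α g))))
  allowed-nonNeg Q-SA  q 0≤q = eval-nonNeg α q 0≤q
  allowed-nonNeg QNS   q q≈0 = subst (0ℚ ≤_) (sym (eval-≈P α q 0P q≈0)) ≤-refl

  falsifies? : ∀ φ → Dec (Falsifies α φ)
  falsifies? = Any.any? (All.all? (λ (v , s) → ¬? (α v Bool.≟ s)))

  ¬falsifies⇒satisfies : ∀ φ → ¬ Falsifies α φ → All (Any (litTrue α)) φ
  ¬falsifies⇒satisfies φ ¬falsified = All.map satisfied (¬Any⇒All¬ φ ¬falsified)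
    where
    satisfied : ∀ {C} → ¬ All (λ l → ¬ litTrue α l) C → Any (litTrue α) C
    satisfied {C} ¬allFalse =
      Any.map (λ {(v , s)} → decidable-stable (α v Bool.≟ s))
              (¬All⇒Any¬ (λ (v , s) → ¬? (α v Bool.≟ s)) C ¬allFalse)

one-plus-nonNeg-positive : ∀ {a b c} → a ≡ 0ℚ → 0ℚ ≤ b → 0ℚ ≤ c → 0ℚ < a + (b + (c + 1ℚ))
one-plus-nonNeg-positive {b = b} {c} refl 0≤b 0≤c =
  subst (0ℚ <_) (sym (+-identityˡ (b + (c + 1ℚ)))) (+-mono-≤-< 0≤b (+-mono-≤-< 0≤c (positive⁻¹ 1ℚ)))

refutation-excludes-play : ∀ {n S} {F : QBF n} (R : Refutation S F) (α : Assignment n) →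
  FollowsStrategy (QBF.prefix F) (Refutation.qu R) α → All (Any (litTrue α)) (QBF.matrix F) → ⊥
refutation-excludes-play {n} {S} {F} R α follows sat =
  <-irrefl (sym lhs≡0)
    (one-plus-nonNeg-positive encTerms≡0 univTerms≥0 (allowed-nonNeg α S q q-allowed))
  where
  open QBF F
  open Refutation R
  encTerms = sumP (List.map (λ i → qp i *P List.lookup (enc matrix) i) (allFin _))
  univTerms = sumP (List.map (universalTerm prefix qu) (allFin n))
  encTerms≡0 : eval α encTerms ≡ 0ℚ
  encTerms≡0 = eval-sumP-zero α _ (allFin _) λ i →
    trans (eval-* α (qp i) _)
          (trans (cong (eval α (qp i) *_) (All.lookup (enc-vanishes α matrix sat) (∈-lookup i)))
                 (*-zeroʳ (eval α (qp i))))
  univTerms≥0 : 0ℚ ≤ eval α univTerms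
  univTerms≥0 = eval-sumP-nonNeg α _ (allFin n) (universalTerm-nonNeg α prefix qu qu-left follows)
  lhs≡0 : eval α encTerms + (eval α univTerms + (eval α q + 1ℚ)) ≡ 0ℚ
  lhs≡0 =
    begin
      eval α encTerms + (eval α univTerms + (eval α q + 1ℚ))
        ≡⟨ cong (λ x → eval α encTerms + (eval α univTerms + (eval α q + x))) (sym (eval-constP α 1ℚ)) ⟩
      eval α encTerms + (eval α univTerms + (eval α q + eval α 1P))
        ≡⟨ cong (λ x → eval α encTerms + (eval α univTerms + x)) (sym (eval-++ α q 1P)) ⟩
      eval α encTerms + (eval α univTerms + eval α (q +P 1P))
        ≡⟨ cong (eval α encTerms +_) (sym (eval-++ α univTerms _)) ⟩
      eval α encTerms + eval α (univTerms +P (q +P 1P))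
        ≡⟨ sym (eval-++ α encTerms _) ⟩
      eval α (encTerms +P (univTerms +P (q +P 1P)))
        ≡⟨ eval-≈P α (encTerms +P (univTerms +P (q +P 1P))) 0P identity ⟩
      0ℚ ∎
    where open ≡-Reasoning

theorem4p3 : ∀ {n} (S : System) (F : QBF n) (R : Refutation S F) →
    ∀ (α : Assignment n) →
      FollowsStrategy (QBF.prefix F) (Refutation.qu R) α →
      Falsifies α (QBF.matrix F)
theorem4p3 S F R α follows with falsifies? α (QBF.matrix F)
... | yes falsified  = falsified
... | no ¬falsified =
  ⊥-elim (refutation-excludes-play R α follows (¬falsifies⇒satisfies α (QBF.matrix F) ¬falsified))
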